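{- For all integers $2\le n\le m$, $\gamma_{2t}(K_n\Box K_m)\ge \min\{m+2,\,2n\}$. Furthermore, $\gamma_{2t}(K_n\Box K_m)=2n$ whenever $m\ge 2n-2$.
   Context: $K_n$ denotes the complete graph on $n$ vertices. The Cartesian product $G\Box H$ has vertex set $V(G)\times V(H)$, with $(u_1,v_1)\sim(u_2,v_2)$ iff either $u_1=u_2$ and $v_1\sim v_2$, or $v_1=v_2$ and $u_1\sim u_2$. A set $S$ of vertices of a graph $G$ is total $2$-dominating if every vertex of $G$ is adjacent to at least two vertices of $S$; $\gamma_{2t}(G)$ is the minimum cardinality of such a set. -}

module Defs where

open import Data.Nat using (ℕ; _≤_)
open import Data.Fin using (Fin)
open import Data.Product using (_×_; Σ; ∃; _,_)
open import Data.Sum using (_⊎_)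
open import Data.List using (List; length)
open import Data.List.Membership.Propositional using (_∈_)
open import Data.List.Relation.Unary.Unique.Propositional using (Unique)
open import Relation.Binary.PropositionalEquality using (_≡_; _≢_)
open import Level using (0ℓ)

record Graph : Set₁ where
  field
    V   : Set
    _~_ : V → V → Set

open Graph public

K : ℕ → Graph
K n = record { V = Fin n ; _~_ = λ u v → u ≢ v }

_□_ : Graph → Graph → Graph
G □ H = record
  { V = V G × V H
  ; _~_ = λ { (u₁ , v₁) (u₂ , v₂) →
      (u₁ ≡ u₂ × _~_ H v₁ v₂) ⊎ (v₁ ≡ v₂ × _~_ G u₁ u₂) } }

-- A vertex set is represented as a duplicate-free list of vertices;
-- its cardinality is the length of the list.
-- S is total 2-dominating: every vertex v has two distinct neighbours in S.
IsTotal2Dominating : (G : Graph) → List (V G) → Set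
IsTotal2Dominating G S =
  Unique S ×
  ((v : V G) → Σ (V G) λ x → Σ (V G) λ y →
      x ≢ y × x ∈ S × y ∈ S × _~_ G v x × _~_ G v y)

γ2t≡ : Graph → ℕ → Set
γ2t≡ G k =
  (Σ (List (V G)) λ S → IsTotal2Dominating G S × length S ≡ k) ×
  ((S : List (V G)) → IsTotal2Dominating G S → k ≤ length S)

{-# OPTIONS --safe #-}
-- If every row of K_n □ K_m contains two vertices of S, then |S| ≥ 2n.  Otherwise some row i
-- contains at most one, so each vertex (i, j) has an S-neighbour in column j outside row i,
-- which already gives m vertices of S.  If row i contains a vertex (i, j₀) of S, then both
-- S-neighbours of (i, j₀) lie in column j₀, so one of them is new, and (i, j₀) itself is a
-- further one: m + 2.  If row i misses S, both S-neighbours of every (i, j) lie in column j,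
-- giving 2m ≥ m + 2.  Conversely two full columns are total 2-dominating, of size 2n.
module Submission where

open import Defs
open import Data.Nat using (ℕ; _≤_; _+_; _*_; _∸_)
open import Data.Nat using (_⊓_)
open import Data.List using (List; length)
open import Data.Product using (_×_)

open import Data.Nat using (suc; s≤s)
open import Data.Nat.Properties
  using (≤-trans; ≤-refl; +-monoʳ-≤; +-comm; +-identityʳ; ⊓-glb; m⊓n≤m; m⊓n≤n; m≤n+m∸n)
open import Data.Fin using (Fin; zero; suc; splitAt; join; punchIn)
open import Data.Fin.Properties
  using (injective⇒≤; join-splitAt; any?; all?; ¬∀⟶∃¬; punchInᵢ≢i)
  renaming (_≟_ to _≟ᶠ_)
open import Data.Product using (Σ; ∃₂; _,_; proj₁; proj₂)
open import Data.Product.Properties using (≡-dec)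
open import Data.Sum using (_⊎_; inj₁; inj₂; [_,_])
open import Data.List using (_++_; map; lookup; allFin)
open import Data.List.Properties using (length-++; length-map; length-tabulate)
open import Data.List.Membership.Propositional using (_∈_)
open import Data.List.Membership.Propositional.Properties
  using (∈-map⁺; ∈-map⁻; ∈-++⁺ˡ; ∈-++⁺ʳ; ∈-allFin)
open import Data.List.Relation.Unary.Any using (index)
open import Data.List.Relation.Unary.Any.Properties using (lookup-index)
open import Data.List.Relation.Unary.Unique.Propositional using (Unique)
import Data.List.Relation.Unary.Unique.Propositional.Properties as Unique
open import Data.List.Relation.Binary.Disjoint.Propositional using (Disjoint)
open import Function using (_∘_)
open import Function.Definitions using (Injective)
open import Relation.Binary.Definitions using (DecidableEquality)
open import Relation.Nullary using (¬_; Dec; yes; no; contradiction)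
open import Relation.Nullary.Decidable using (_×-dec_; ¬?)
open import Relation.Binary.PropositionalEquality
  using (_≡_; _≢_; refl; sym; trans; cong; cong₂; subst; module ≡-Reasoning)

module _ {A : Set} (S : List A) where

  injection-into⇒≤length : ∀ {k} {f : Fin k → A} →
    Injective _≡_ _≡_ f → (∀ i → f i ∈ S) → k ≤ length S
  injection-into⇒≤length {f = f} f-inj f∈S = injective⇒≤ λ {i} {j} same-index → f-inj (begin
    f i                      ≡⟨ lookup-index (f∈S i) ⟩
    lookup S (index (f∈S i)) ≡⟨ cong (lookup S) same-index ⟩
    lookup S (index (f∈S j)) ≡⟨ lookup-index (f∈S j) ⟨
    f j                      ∎)
    where open ≡-Reasoning

  disjoint-injections-into⇒≤length : ∀ {a b} {p : Fin a → A} {q : Fin b → A} →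
    Injective _≡_ _≡_ p → Injective _≡_ _≡_ q → (∀ i j → p i ≢ q j) →
    (∀ i → p i ∈ S) → (∀ j → q j ∈ S) → a + b ≤ length S
  disjoint-injections-into⇒≤length {a} {b} {p} {q} p-inj q-inj p≢q p∈S q∈S =
    injection-into⇒≤length (λ eq → splitAt-inj (copair-inj eq)) (copair∈S ∘ splitAt a)
    where
    copair∈S : ∀ x → [ p , q ] x ∈ S
    copair∈S (inj₁ i) = p∈S i
    copair∈S (inj₂ j) = q∈S j

    copair-inj : Injective _≡_ _≡_ [ p , q ]
    copair-inj {inj₁ i} {inj₁ i'} eq = cong inj₁ (p-inj eq)
    copair-inj {inj₁ i} {inj₂ j}  eq = contradiction eq (p≢q i j)
    copair-inj {inj₂ j} {inj₁ i}  eq = contradiction (sym eq) (p≢q i j)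
    copair-inj {inj₂ j} {inj₂ j'} eq = cong inj₂ (q-inj eq)

    splitAt-inj : Injective _≡_ _≡_ (splitAt a {b})
    splitAt-inj {k} {k'} eq =
      trans (sym (join-splitAt a b k)) (trans (cong (join a b) eq) (join-splitAt a b k'))

distinct⇒one-differs : ∀ {A : Set} → DecidableEquality A → ∀ {x y : A} → x ≢ y → ∀ w →
  Σ A λ z → (z ≡ x ⊎ z ≡ y) × z ≢ w
distinct⇒one-differs _≟_ {x} {y} x≢y w with x ≟ w
... | no  x≢w  = x , inj₁ refl , x≢w
... | yes refl = y , inj₂ refl , x≢y ∘ sym

module _ {n m : ℕ} where

  column-section-injective : {f : Fin m → Fin n × Fin m} →
    (∀ j → proj₂ (f j) ≡ j) → Injective _≡_ _≡_ f
  column-section-injective col {j} {j'} eq = trans (sym (col j)) (trans (cong proj₂ eq) (col j'))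

  □-irreflexive : ∀ v → ¬ _~_ (K n □ K m) v v
  □-irreflexive _ (inj₁ (_ , j≢j)) = j≢j refl
  □-irreflexive _ (inj₂ (_ , i≢i)) = i≢i refl

  neighbour-off-row-in-column : ∀ {i j x} → _~_ (K n □ K m) (i , j) x → proj₁ x ≢ i → proj₂ x ≡ j
  neighbour-off-row-in-column (inj₁ (i≡ , _)) x≢i = contradiction (sym i≡) x≢i
  neighbour-off-row-in-column (inj₂ (j≡ , _)) _   = sym j≡

module LowerBound {n m : ℕ} (S : List (Fin n × Fin m)) where

  open import Data.List.Membership.DecPropositional (≡-dec (_≟ᶠ_ {n}) (_≟ᶠ_ {m})) using (_∈?_)

  TwoInRow : Fin n → Set
  TwoInRow i = ∃₂ λ j j' → j ≢ j' × (i , j) ∈ S × (i , j') ∈ S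

  twoInRow? : ∀ i → Dec (TwoInRow i)
  twoInRow? i = any? λ j → any? λ j' → ¬? (j ≟ᶠ j') ×-dec (i , j) ∈? S ×-dec (i , j') ∈? S

  twoInEveryRow⇒≤length : (∀ i → TwoInRow i) → n + n ≤ length S
  twoInEveryRow⇒≤length two =
    disjoint-injections-into⇒≤length S (cong proj₁) (cong proj₁) first≢second first∈S second∈S
    where
    first second : Fin n → Fin n × Fin m
    first i  = i , proj₁ (two i)
    second i = i , proj₁ (proj₂ (two i))

    first∈S : ∀ i → first i ∈ S
    first∈S i = proj₁ (proj₂ (proj₂ (proj₂ (two i))))

    second∈S : ∀ i → second i ∈ S
    second∈S i = proj₂ (proj₂ (proj₂ (proj₂ (two i))))

    first≢second : ∀ i i' → first i ≢ second i'
    first≢second i i' eq with cong proj₁ eq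
    ... | refl = proj₁ (proj₂ (proj₂ (two i))) (cong proj₂ eq)

  module PoorRow (D : IsTotal2Dominating (K n □ K m) S) (i : Fin n) (¬two : ¬ TwoInRow i) where

    in-row-unique : ∀ {x y} → x ∈ S → y ∈ S → proj₁ x ≡ i → proj₁ y ≡ i → x ≡ y
    in-row-unique {_ , j} {_ , j'} x∈S y∈S refl refl with j ≟ᶠ j'
    ... | yes refl  = refl
    ... | no  j≢j'  = contradiction (j , j' , j≢j' , x∈S , y∈S) ¬two

    record InColumnOffRow (j : Fin m) (x : Fin n × Fin m) : Set where
      constructor inColumnOffRow
      field
        member    : x ∈ S
        in-column : proj₂ x ≡ j
        off-row   : proj₁ x ≢ i
    open InColumnOffRow

    column-representative : ∀ j → Σ (Fin n × Fin m) (InColumnOffRow j)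
    column-representative j with proj₂ D (i , j)
    ... | x , y , x≢y , x∈S , y∈S , ij~x , ij~y with proj₁ x ≟ᶠ i | proj₁ y ≟ᶠ i
    ... | no x≢i | _      = x , inColumnOffRow x∈S (neighbour-off-row-in-column ij~x x≢i) x≢i
    ... | yes _  | no y≢i = y , inColumnOffRow y∈S (neighbour-off-row-in-column ij~y y≢i) y≢i
    ... | yes xi | yes yi = contradiction (in-row-unique x∈S y∈S xi yi) x≢y

    column-pair : ∀ {j} → (∀ {x} → x ∈ S → _~_ (K n □ K m) (i , j) x → proj₁ x ≢ i) →
      ∃₂ λ x y → x ≢ y × InColumnOffRow j x × InColumnOffRow j y
    column-pair {j} avoids-row with proj₂ D (i , j)
    ... | x , y , x≢y , x∈S , y∈S , ij~x , ij~y = x , y , x≢y , in-column′ x∈S ij~x , in-column′ y∈S ij~y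
      where
      in-column′ : ∀ {z} → z ∈ S → _~_ (K n □ K m) (i , j) z → InColumnOffRow j z
      in-column′ z∈S ij~z = inColumnOffRow z∈S
        (neighbour-off-row-in-column ij~z (avoids-row z∈S ij~z)) (avoids-row z∈S ij~z)

    representative : Fin m → Fin n × Fin m
    representative j = proj₁ (column-representative j)

    representative-spec : ∀ j → InColumnOffRow j (representative j)
    representative-spec j = proj₂ (column-representative j)

    representative-injective : Injective _≡_ _≡_ representative
    representative-injective = column-section-injective (in-column ∘ representative-spec)

    occupied⇒≤length : ∀ {j₀} → (i , j₀) ∈ S → m + 2 ≤ length S
    occupied⇒≤length {j₀} ij₀∈S =
      disjoint-injections-into⇒≤length S representative-injective extra-injective
        representative≢extra (member ∘ representative-spec) extra∈S
      where
      avoids-row : ∀ {x} → x ∈ S → _~_ (K n □ K m) (i , j₀) x → proj₁ x ≢ i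
      avoids-row x∈S ij₀~x x≡i =
        □-irreflexive (i , j₀)
          (subst (_~_ (K n □ K m) (i , j₀)) (in-row-unique x∈S ij₀∈S x≡i refl) ij₀~x)

      other : Σ (Fin n × Fin m) λ z → InColumnOffRow j₀ z × z ≢ representative j₀
      other with column-pair avoids-row
      ... | x , y , x≢y , x-spec , y-spec
          with distinct⇒one-differs (≡-dec _≟ᶠ_ _≟ᶠ_) x≢y (representative j₀)
      ... | z , inj₁ refl , z≢r = z , x-spec , z≢r
      ... | z , inj₂ refl , z≢r = z , y-spec , z≢r

      z : Fin n × Fin m
      z = proj₁ other

      z-spec : InColumnOffRow j₀ z
      z-spec = proj₁ (proj₂ other)

      extra : Fin 2 → Fin n × Fin m
      extra zero       = i , j₀
      extra (suc zero) = z

      extra∈S : ∀ k → extra k ∈ S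
      extra∈S zero       = ij₀∈S
      extra∈S (suc zero) = member z-spec

      extra-injective : Injective _≡_ _≡_ extra
      extra-injective {zero}     {zero}     _  = refl
      extra-injective {zero}     {suc zero} eq = contradiction (cong proj₁ (sym eq)) (off-row z-spec)
      extra-injective {suc zero} {zero}     eq = contradiction (cong proj₁ eq) (off-row z-spec)
      extra-injective {suc zero} {suc zero} _  = refl

      representative≢extra : ∀ j k → representative j ≢ extra k
      representative≢extra j zero eq = off-row (representative-spec j) (cong proj₁ eq)
      representative≢extra j (suc zero) eq
        with trans (sym (in-column (representative-spec j))) (trans (cong proj₂ eq) (in-column z-spec))
      ... | refl = proj₂ (proj₂ other) (sym eq)

    empty⇒≤length : (∀ j → ¬ (i , j) ∈ S) → m + m ≤ length S
    empty⇒≤length empty =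
      disjoint-injections-into⇒≤length S
        (column-section-injective (in-column ∘ first-spec))
        (column-section-injective (in-column ∘ second-spec))
        first≢second (member ∘ first-spec) (member ∘ second-spec)
      where
      avoids-row : ∀ {j x} → x ∈ S → _~_ (K n □ K m) (i , j) x → proj₁ x ≢ i
      avoids-row {x = x} x∈S _ x≡i = empty (proj₂ x) (subst (λ r → (r , proj₂ x) ∈ S) x≡i x∈S)

      pair : ∀ j → ∃₂ λ x y → x ≢ y × InColumnOffRow j x × InColumnOffRow j y
      pair j = column-pair avoids-row

      first second : Fin m → Fin n × Fin m
      first j  = proj₁ (pair j)
      second j = proj₁ (proj₂ (pair j))

      first-spec : ∀ j → InColumnOffRow j (first j)
      first-spec j = proj₁ (proj₂ (proj₂ (proj₂ (pair j))))

      second-spec : ∀ j → InColumnOffRow j (second j)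
      second-spec j = proj₂ (proj₂ (proj₂ (proj₂ (pair j))))

      first≢second : ∀ j j' → first j ≢ second j'
      first≢second j j' eq
        with trans (sym (in-column (first-spec j))) (trans (cong proj₂ eq) (in-column (second-spec j')))
      ... | refl = proj₁ (proj₂ (proj₂ (pair j))) eq

    poor-row⇒≤length : 2 ≤ m → m + 2 ≤ length S
    poor-row⇒≤length 2≤m with any? (λ j → (i , j) ∈? S)
    ... | yes (j₀ , ij₀∈S) = occupied⇒≤length ij₀∈S
    ... | no  empty        = ≤-trans (+-monoʳ-≤ m 2≤m) (empty⇒≤length λ j ij∈S → empty (j , ij∈S))

  lower-bound : IsTotal2Dominating (K n □ K m) S → 2 ≤ m → (m + 2) ⊓ (2 * n) ≤ length S
  lower-bound D 2≤m with all? twoInRow?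
  ... | yes two = ≤-trans (m⊓n≤n (m + 2) (2 * n))
                    (subst (λ k → n + k ≤ length S) (sym (+-identityʳ n)) (twoInEveryRow⇒≤length two))
  ... | no ¬two with ¬∀⟶∃¬ n TwoInRow twoInRow? ¬two
  ... | i , ¬two-i = ≤-trans (m⊓n≤m (m + 2) (2 * n)) (PoorRow.poor-row⇒≤length D i ¬two-i 2≤m)

twoColumns : (n m : ℕ) → List (Fin n × Fin (suc (suc m)))
twoColumns n m = map (_, zero) (allFin n) ++ map (_, suc zero) (allFin n)

module _ {n m : ℕ} where

  column₀∈twoColumns : ∀ i → (i , zero) ∈ twoColumns n m
  column₀∈twoColumns i = ∈-++⁺ˡ (∈-map⁺ (_, zero) (∈-allFin i))

  column₁∈twoColumns : ∀ i → (i , suc zero) ∈ twoColumns n m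
  column₁∈twoColumns i = ∈-++⁺ʳ (map (_, zero) (allFin n)) (∈-map⁺ (_, suc zero) (∈-allFin i))

  length-twoColumns : length (twoColumns n m) ≡ 2 * n
  length-twoColumns = begin
    length (twoColumns n m)   ≡⟨ length-++ (map (_, zero) (allFin n)) ⟩
    length (map (_, zero) (allFin n)) + length (map (_, suc zero) (allFin n))
                              ≡⟨ cong₂ _+_ (length-column zero) (length-column (suc zero)) ⟩
    n + n                     ≡⟨ cong (n +_) (+-identityʳ n) ⟨
    2 * n                     ∎
    where
    open ≡-Reasoning
    length-column : ∀ c → length (map (_, c) (allFin n)) ≡ n
    length-column c = trans (length-map (_, c) (allFin n)) (length-tabulate (λ i → i))

  twoColumns-unique : Unique (twoColumns n m)
  twoColumns-unique = Unique.++⁺ (column-unique zero) (column-unique (suc zero)) columns-disjoint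
    where
    column-unique : ∀ c → Unique (map (_, c) (allFin n))
    column-unique c = Unique.map⁺ (cong proj₁) (Unique.allFin⁺ n)

    columns-disjoint : Disjoint (map (_, zero) (allFin n)) (map (_, suc zero) (allFin n))
    columns-disjoint (v∈₀ , v∈₁) with ∈-map⁻ (_, zero) v∈₀ | ∈-map⁻ (_, suc zero) v∈₁
    ... | _ , _ , refl | _ , _ , ()

twoColumns-dominating : ∀ {n m} →
  IsTotal2Dominating (K (suc (suc n)) □ K (suc (suc m))) (twoColumns (suc (suc n)) m)
twoColumns-dominating = twoColumns-unique , λ where
  (i , zero) →
    (i , suc zero) , (punchIn i zero , zero) , (λ ()) ,
    column₁∈twoColumns i , column₀∈twoColumns (punchIn i zero) ,
    inj₁ (refl , λ ()) , inj₂ (refl , punchInᵢ≢i i zero ∘ sym)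
  (i , suc zero) →
    (i , zero) , (punchIn i zero , suc zero) , (λ ()) ,
    column₀∈twoColumns i , column₁∈twoColumns (punchIn i zero) ,
    inj₁ (refl , λ ()) , inj₂ (refl , punchInᵢ≢i i zero ∘ sym)
  (i , suc (suc j)) →
    (i , zero) , (i , suc zero) , (λ ()) ,
    column₀∈twoColumns i , column₁∈twoColumns i ,
    inj₁ (refl , λ ()) , inj₁ (refl , λ ())

total2Dominating-of-size-2n : ∀ {n m} → 2 ≤ n → 2 ≤ m →
  Σ (List (Fin n × Fin m)) λ S → IsTotal2Dominating (K n □ K m) S × length S ≡ 2 * n
total2Dominating-of-size-2n {suc (suc n)} {suc (suc m)} (s≤s (s≤s _)) (s≤s (s≤s _)) =
  twoColumns (suc (suc n)) m , twoColumns-dominating , length-twoColumns {suc (suc n)} {m}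

proposition2p4 : (n m : ℕ) → 2 ≤ n → n ≤ m →
    ((S : List (V (K n □ K m))) → IsTotal2Dominating (K n □ K m) S →
        (m + 2) ⊓ (2 * n) ≤ length S)
    × (2 * n ∸ 2 ≤ m → γ2t≡ (K n □ K m) (2 * n))
proposition2p4 n m 2≤n n≤m = lower , exact
  where
  2≤m : 2 ≤ m
  2≤m = ≤-trans 2≤n n≤m

  lower : (S : List (V (K n □ K m))) → IsTotal2Dominating (K n □ K m) S →
    (m + 2) ⊓ (2 * n) ≤ length S
  lower S D = LowerBound.lower-bound S D 2≤m

  exact : 2 * n ∸ 2 ≤ m → γ2t≡ (K n □ K m) (2 * n)
  exact 2n∸2≤m = total2Dominating-of-size-2n 2≤n 2≤m ,
    λ S D → ≤-trans (⊓-glb 2n≤m+2 ≤-refl) (lower S D)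
    where
    2n≤m+2 : 2 * n ≤ m + 2
    2n≤m+2 = ≤-trans (m≤n+m∸n (2 * n) 2)
      (subst (2 + (2 * n ∸ 2) ≤_) (+-comm 2 m) (+-monoʳ-≤ 2 2n∸2≤m))
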